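{- Let $n\geq 1$, $k\in\{4,5,6\}$, $a=2[n,n+1,\ldots,n+k]$, and $b=L_nL_{n+1}\cdots L_{n+k}$. Then: (i) If $k=4$, then $z(b)=3a$ if $n\equiv 2,14,18,30\pmod{36}$, and $z(b)=a$ otherwise. (ii) If $k=5$, then $z(b)=3a$ if $n\equiv 1,2,13,14,17,18,29,30\pmod{36}$, and $z(b)=a$ otherwise. (iii) If $k=6$, then $z(b)=3a$ if $n\equiv 1,2,12,13,14,16,17,18,28,29\pmod{36}$, and $z(b)=a$ otherwise.
   Context: $F_n$ is the $n$th Fibonacci number ($F_1=F_2=1$, $F_n=F_{n-1}+F_{n-2}$) and $L_n$ the $n$th Lucas number ($L_1=1$, $L_2=3$, $L_n=L_{n-1}+L_{n-2}$). For a positive integer $m$, $z(m)$ is the smallest positive integer $k$ with $m\mid F_k$. $[\cdots]$ denotes lcm. -}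

module Defs where

open import Data.Nat using (ℕ; zero; suc; _+_; _*_; _<_; _%_)
open import Data.Nat.Divisibility using (_∣_)
open import Data.Nat.LCM using (lcm)
open import Relation.Nullary using (¬_)
open import Data.Product using (_×_)

fib : ℕ → ℕ
fib zero = 0
fib (suc zero) = 1
fib (suc (suc n)) = fib (suc n) + fib n

lucas : ℕ → ℕ
lucas zero = 2
lucas (suc zero) = 1
lucas (suc (suc n)) = lucas (suc n) + lucas n

IsRankOfApparition : ℕ → ℕ → Set
IsRankOfApparition m k = (0 < k) × (m ∣ fib k) × (∀ j → 0 < j → j < k → ¬ (m ∣ fib j))

lcmRange : ℕ → ℕ → ℕ
lcmRange n zero = n
lcmRange n (suc k) = lcm (lcmRange n k) (n + suc k)

lucasProd : ℕ → ℕ → ℕ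
lucasProd n zero = lucas n
lucasProd n (suc k) = lucasProd n k * lucas (n + suc k)

module Submission where

-- Every L_m with m ≥ 2 has rank of apparition 2m, so z(b) is a multiple of a; conversely
-- b ∣ F_c for c ∈ {a, 3a} is checked prime by prime through p-adic valuations. A prime
-- p ≥ 5 divides at most one of seven consecutive Lucas numbers, and ν₂(b) ≤ 5 ≤ ν₂(F_c).
-- The prime 3 decides between a and 3a: ν₃(F_c) = 1 + ν₃(c) when 4 ∣ c, and 3 ∣ L_m
-- exactly when m ≡ 2 (mod 4), with then ν₃(L_m) = 1 + ν₃(m). So z(b) = a if
-- ν₃(b) ≤ 1 + ν₃(a), and z(b) = 3a if ν₃(b) = 2 + ν₃(a). Both conditions depend only on
-- n mod 36, apart from the valuation B ≥ 2 of the (unique) multiple of 9 among n, …, n + k,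
-- which enters linearly; they are verified by evaluation over all residues.

open import Defs
open import Data.Bool using (Bool; true; false; T; _∧_; _∨_; if_then_else_)
open import Data.Bool.Properties using (T-∧; T-∨)
open import Data.Empty using (⊥-elim)
open import Data.List using (List; _∷_; [])
open import Data.List.Membership.Propositional using (_∈_)
open import Data.List.Relation.Unary.All using (_∷_)
open import Data.Nat
open import Data.Nat.Coprimality using (Coprime; coprime?; coprime-divisor)
open import Data.Nat.DivMod
open import Data.Nat.Divisibility
open import Data.Nat.GCD using (gcd)
open import Data.Nat.Induction using (<-rec)
open import Data.Nat.LCM using (lcm; lcm-least; m∣lcm[m,n]; n∣lcm[m,n]; gcd*lcm)
open import Data.Nat.ListAction using (product)
open import Data.Nat.Primality
open import Data.Nat.Primality.Factorisation using (factorise)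
open import Data.Nat.Properties
open import Data.Nat.Tactic.RingSolver using (solve-∀)
open import Data.List.Membership.DecPropositional _≟_ using (_∈?_)
open import Data.Product
open import Data.Sum using (_⊎_; inj₁; inj₂; [_,_])
open import Data.Unit using (tt)
open import Function using (_∘_)
open import Function.Bundles using (Equivalence)
open import Relation.Binary.Definitions using (tri<; tri≈; tri>)
open import Relation.Binary.PropositionalEquality hiding ([_])
open import Relation.Nullary
open import Relation.Nullary.Decidable

-- Fibonacci and Lucas numbers

m+m≡2*m : ∀ m → m + m ≡ 2 * m
m+m≡2*m m = cong (m +_) (sym (+-identityʳ m))

fib-suc-+ : ∀ m n → fib (suc (m + n)) ≡ fib (suc m) * fib (suc n) + fib m * fib n
fib-suc-+ zero n = sym (trans (+-identityʳ _) (+-identityʳ _))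
fib-suc-+ (suc m) n = begin
  fib (suc (suc m + n))                                         ≡⟨ cong (λ x → fib (suc x)) (sym (+-suc m n)) ⟩
  fib (suc (m + suc n))                                         ≡⟨ fib-suc-+ m (suc n) ⟩
  fib (suc m) * (fib (suc n) + fib n) + fib m * fib (suc n)     ≡⟨ regroup (fib (suc m)) (fib m) (fib (suc n)) (fib n) ⟩
  (fib (suc m) + fib m) * fib (suc n) + fib (suc m) * fib n     ∎
  where
  open ≡-Reasoning
  regroup : ∀ x y z w → x * (z + w) + y * z ≡ (x + y) * z + x * w
  regroup = solve-∀

fib[m]∣fib[t*m] : ∀ m t → fib m ∣ fib (t * m)
fib[m]∣fib[t*m] m zero = divides 0 refl
fib[m]∣fib[t*m] zero (suc t) = subst (λ x → 0 ∣ fib x) (sym (*-zeroʳ (suc t))) ∣-refl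
fib[m]∣fib[t*m] (suc m) (suc t) = subst (fib (suc m) ∣_) (sym (fib-suc-+ m (t * suc m)))
  (∣m∣n⇒∣m+n (∣m⇒∣m*n _ ∣-refl) (∣n⇒∣m*n (fib m) (fib[m]∣fib[t*m] (suc m) t)))

∣⇒fib∣fib : ∀ {m n} → m ∣ n → fib m ∣ fib n
∣⇒fib∣fib {m} (divides t refl) = fib[m]∣fib[t*m] m t

fib-coprime-suc : ∀ n → Coprime (fib n) (fib (suc n))
fib-coprime-suc zero (_ , d∣1) = ∣1⇒≡1 d∣1
fib-coprime-suc (suc n) (d∣a , d∣b) = fib-coprime-suc n (∣m+n∣m⇒∣n d∣b d∣a , d∣a)

∣fib⇒coprime-fib-suc : ∀ {d} n → d ∣ fib n → Coprime d (fib (suc n))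
∣fib⇒coprime-fib-suc n d∣F (e∣d , e∣F') = fib-coprime-suc n (∣-trans e∣d d∣F , e∣F')

fib-cancelˡ-∣ : ∀ {d} m n → d ∣ fib (m + n) → d ∣ fib m → d ∣ fib n
fib-cancelˡ-∣ m zero _ _ = divides 0 refl
fib-cancelˡ-∣ {d} m (suc n) d∣F[m+n] d∣F[m] =
  coprime-divisor (∣fib⇒coprime-fib-suc m d∣F[m]) (∣m+n∣m⇒∣n d∣sum (∣m⇒∣m*n (fib n) d∣F[m]))
  where
  d∣sum : d ∣ fib m * fib n + fib (suc m) * fib (suc n)
  d∣sum = subst (d ∣_) (trans (cong fib (+-suc m n)) (trans (fib-suc-+ m n) (+-comm (fib (suc m) * fib (suc n)) _))) d∣F[m+n]

fib-%-∣ : ∀ {d} m n .{{_ : NonZero n}} → d ∣ fib m → d ∣ fib n → d ∣ fib (m % n)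
fib-%-∣ {d} m n d∣F[m] d∣F[n] = fib-cancelˡ-∣ (m / n * n) (m % n) d∣F[m/n*n+m%n] (∣-trans d∣F[n] (fib[m]∣fib[t*m] n (m / n)))
  where
  d∣F[m/n*n+m%n] : d ∣ fib (m / n * n + m % n)
  d∣F[m/n*n+m%n] = subst (λ x → d ∣ fib x) (trans (m≡m%n+[m/n]*n m n) (+-comm (m % n) _)) d∣F[m]

fib-pos : ∀ n → 0 < fib (suc n)
fib-pos zero = z<s
fib-pos (suc n) = ≤-trans (fib-pos n) (m≤m+n _ _)

0<fib : ∀ {m} → 0 < m → 0 < fib m
0<fib {suc m} _ = fib-pos m

fib-≤-suc : ∀ n → fib n ≤ fib (suc n)
fib-≤-suc zero = z≤n
fib-≤-suc (suc n) = m≤m+n _ _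

fib-mono-≤ : ∀ {m} n → m ≤ n → fib m ≤ fib n
fib-mono-≤ zero z≤n = z≤n
fib-mono-≤ (suc n) m≤1+n with m≤n⇒m<n∨m≡n m≤1+n
... | inj₂ refl = ≤-refl
... | inj₁ m<1+n = ≤-trans (fib-mono-≤ n (≤-pred m<1+n)) (fib-≤-suc n)

lucas-suc : ∀ n → lucas (suc n) ≡ fib (suc (suc n)) + fib n
lucas-suc zero = refl
lucas-suc (suc zero) = refl
lucas-suc (suc (suc n)) = trans (cong₂ _+_ (lucas-suc (suc n)) (lucas-suc n)) (regroup (fib (suc n)) (fib n))
  where
  regroup : ∀ a b → (((a + b) + a) + a) + ((a + b) + b) ≡ (((a + b) + a) + (a + b)) + (a + b)
  regroup = solve-∀

lucas+fib : ∀ n → lucas n + fib n ≡ 2 * fib (suc n)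
lucas+fib zero = refl
lucas+fib (suc n) = trans (cong (_+ fib (suc n)) (lucas-suc n)) (regroup (fib (suc n)) (fib n))
  where
  regroup : ∀ a b → ((a + b) + b) + a ≡ 2 * (a + b)
  regroup = solve-∀

fib[m+m]≡fib[m]*lucas[m] : ∀ m → fib (m + m) ≡ fib m * lucas m
fib[m+m]≡fib[m]*lucas[m] zero = refl
fib[m+m]≡fib[m]*lucas[m] (suc m) = begin
  fib (suc m + suc m)                                     ≡⟨ fib-suc-+ m (suc m) ⟩
  fib (suc m) * fib (suc (suc m)) + fib m * fib (suc m)   ≡⟨ factor (fib (suc m)) (fib (suc (suc m))) (fib m) ⟩
  fib (suc m) * (fib (suc (suc m)) + fib m)               ≡⟨ cong (fib (suc m) *_) (lucas-suc m) ⟨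
  fib (suc m) * lucas (suc m)                             ∎
  where
  open ≡-Reasoning
  factor : ∀ x y z → x * y + z * x ≡ x * (y + z)
  factor = solve-∀

fib[2*m]≡fib[m]*lucas[m] : ∀ m → fib (2 * m) ≡ fib m * lucas m
fib[2*m]≡fib[m]*lucas[m] m = trans (cong fib (sym (m+m≡2*m m))) (fib[m+m]≡fib[m]*lucas[m] m)

lucas∣fib[2*m] : ∀ m → lucas m ∣ fib (2 * m)
lucas∣fib[2*m] m = divides (fib m) (fib[2*m]≡fib[m]*lucas[m] m)

fib<lucas : ∀ m → 2 ≤ m → fib m < lucas m
fib<lucas (suc zero) (s≤s ())
fib<lucas (suc (suc m)) _ = subst (fib (suc (suc m)) <_) (sym (lucas-suc (suc m)))
  (<-≤-trans (m<m+n _ (fib-pos m)) (m≤m+n _ _))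

lucas-pos : ∀ m → 0 < lucas m
lucas-pos zero = z<s
lucas-pos (suc m) = subst (0 <_) (sym (lucas-suc m)) (≤-trans (fib-pos (suc m)) (m≤m+n _ _))

∣lucas∧∣fib⇒∣2 : ∀ {d} m → d ∣ lucas m → d ∣ fib m → d ∣ 2
∣lucas∧∣fib⇒∣2 {d} m d∣L d∣F = coprime-divisor (∣fib⇒coprime-fib-suc m d∣F)
  (subst (d ∣_) (trans (lucas+fib m) (*-comm 2 (fib (suc m)))) (∣m∣n⇒∣m+n d∣L d∣F))

fib[3*m] : ∀ k → fib (3 * suc k) ≡ fib (suc k) * (3 * fib (suc (suc k)) * fib k + 2 * (fib (suc k) * fib (suc k)))
fib[3*m] k = begin
  fib (3 * suc k)                                                         ≡⟨ cong fib (split k) ⟩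
  fib (suc (suc k + suc k + k))                                           ≡⟨ fib-suc-+ (suc k + suc k) k ⟩
  fib (suc (suc k + suc k)) * F₁ + fib (suc k + suc k) * F₀
    ≡⟨ cong₂ (λ x y → x * F₁ + y * F₀) (fib-suc-+ (suc k) (suc k)) (fib[m+m]≡fib[m]*lucas[m] (suc k)) ⟩
  (F₂ * F₂ + F₁ * F₁) * F₁ + F₁ * lucas (suc k) * F₀
    ≡⟨ cong (λ x → (F₂ * F₂ + F₁ * F₁) * F₁ + F₁ * x * F₀) (lucas-suc k) ⟩
  (F₂ * F₂ + F₁ * F₁) * F₁ + F₁ * (F₂ + F₀) * F₀                         ≡⟨ expand F₁ F₀ ⟩
  F₁ * (3 * F₂ * F₀ + 2 * (F₁ * F₁))                                      ∎
  where
  open ≡-Reasoning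
  F₀ = fib k
  F₁ = fib (suc k)
  F₂ = fib (suc (suc k))
  split : ∀ k → 3 * suc k ≡ suc (suc k + suc k + k)
  split = solve-∀
  expand : ∀ g p → ((g + p) * (g + p) + g * g) * g + g * ((g + p) + p) * p ≡ g * (3 * (g + p) * p + 2 * (g * g))
  expand = solve-∀

rank∣ : ∀ {d z m} → IsRankOfApparition d z → d ∣ fib m → z ∣ m
rank∣ {d} {z} {m} (0<z , d∣F[z] , minimal) d∣F[m] = m%n≡0⇒n∣m m z m%z≡0
  where
  instance _ = >-nonZero 0<z
  m%z≡0 : m % z ≡ 0
  m%z≡0 with m % z | m%n<n m z | fib-%-∣ m z d∣F[m] d∣F[z]
  ... | zero  | _   | _       = refl
  ... | suc r | r<z | d∣F[r] = ⊥-elim (minimal (suc r) z<s r<z d∣F[r])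

rank? : ∀ d z → Dec (IsRankOfApparition d z)
rank? d z = 0 <? z ×-dec d ∣? fib z ×-dec map′ (λ h j 0<j j<z → h j<z 0<j) (λ h {j} j<z 0<j → h j 0<j j<z)
  (allUpTo? (λ j → 0 <? j →-dec ¬? (d ∣? fib j)) z)

rank-by-divisibility : ∀ {b a} → 0 < a → b ∣ fib a → (∀ j → b ∣ fib j → a ∣ j) → IsRankOfApparition b a
rank-by-divisibility 0<a b∣F[a] a∣ = 0<a , b∣F[a] , λ j 0<j j<a b∣F[j] → <⇒≱ j<a (∣⇒≤ {{>-nonZero 0<j}} (a∣ j b∣F[j]))

rank-triple : ∀ {b a} → 0 < a → b ∣ fib (3 * a) → ¬ b ∣ fib a → (∀ j → b ∣ fib j → a ∣ j) →
              IsRankOfApparition b (3 * a)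
rank-triple {b} {a} 0<a b∣F[3a] b∤F[a] a∣ = *-monoʳ-< 3 0<a , b∣F[3a] , minimal
  where
  minimal : ∀ j → 0 < j → j < 3 * a → ¬ b ∣ fib j
  minimal j 0<j j<3a b∣F[j] with a∣ j b∣F[j]
  ... | divides 0 refl = <-irrefl refl 0<j
  ... | divides 1 refl = b∤F[a] (subst (λ x → b ∣ fib x) (+-identityʳ a) b∣F[j])
  ... | divides 2 refl = b∤F[a] (fib-cancelˡ-∣ (2 * a) a (subst (λ x → b ∣ fib x) (3a≡2a+a a) b∣F[3a])
                                  b∣F[j])
    where
    3a≡2a+a : ∀ a → 3 * a ≡ 2 * a + a
    3a≡2a+a = solve-∀
  ... | divides (suc (suc (suc q))) refl = <⇒≱ j<3a (*-monoˡ-≤ a {3} {suc (suc (suc q))} (s≤s (s≤s (s≤s z≤n))))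

-- L_m ∤ F_j for 0 < j ≤ m by size, and for m < j < 2m since then L_m ∣ F_(2m-j).
lucas-rank : ∀ m → 2 ≤ m → IsRankOfApparition (lucas m) (2 * m)
lucas-rank m 2≤m = *-monoʳ-< 2 (≤-trans (s≤s z≤n) 2≤m) , lucas∣fib[2*m] m , minimal
  where
  small : ∀ j → 0 < j → j ≤ m → ¬ lucas m ∣ fib j
  small (suc j) _ j≤m L∣F = <⇒≱ (fib<lucas m 2≤m)
    (≤-trans (∣⇒≤ {{>-nonZero (fib-pos j)}} L∣F) (fib-mono-≤ m j≤m))
  minimal : ∀ j → 0 < j → j < 2 * m → ¬ lucas m ∣ fib j
  minimal j 0<j j<2m L∣F[j] with j ≤? m
  ... | yes j≤m = small j 0<j j≤m L∣F[j]
  ... | no j≰m = small (2 * m ∸ j) (m<n⇒0<n∸m j<2m) 2m∸j≤m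
      (fib-cancelˡ-∣ j (2 * m ∸ j) (subst (λ x → lucas m ∣ fib x) (sym (m+[n∸m]≡n (<⇒≤ j<2m))) (lucas∣fib[2*m] m)) L∣F[j])
    where
    2m∸j≤m : 2 * m ∸ j ≤ m
    2m∸j≤m = subst (2 * m ∸ j ≤_) (trans (cong (_∸ m) (sym (m+m≡2*m m))) (m+n∸n≡m m m))
      (∸-monoʳ-≤ (2 * m) (<⇒≤ (≰⇒> j≰m)))

lucas-divisor-rank : ∀ {d z} m → IsRankOfApparition d z → ¬ d ∣ 2 → d ∣ lucas m → z ∣ 2 * m × ¬ z ∣ m
lucas-divisor-rank m rank@(_ , d∣F[z] , _) d∤2 d∣L =
  rank∣ rank (∣-trans d∣L (lucas∣fib[2*m] m)) ,
  λ z∣m → d∤2 (∣lucas∧∣fib⇒∣2 m d∣L (∣-trans d∣F[z] (∣⇒fib∣fib z∣m)))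

even-multiple : ∀ q δ → 2 * δ ∣ q * δ ⊎ 2 * δ ∣ suc q * δ
even-multiple zero δ = inj₁ (divides 0 refl)
even-multiple (suc q) δ with even-multiple q δ
... | inj₂ 2δ∣[1+q]δ = inj₁ 2δ∣[1+q]δ
... | inj₁ 2δ∣qδ = inj₂ (subst (2 * δ ∣_) (shift q δ) (∣m∣n⇒∣m+n ∣-refl 2δ∣qδ))
  where
  shift : ∀ q δ → 2 * δ + q * δ ≡ suc (suc q) * δ
  shift = solve-∀

-- By lucas-divisor-rank both x and x + δ would be odd multiples of δ.
lucas-shift-coprime : ∀ {d} δ x → IsRankOfApparition d (2 * δ) → ¬ d ∣ 2 → d ∣ lucas x → ¬ d ∣ lucas (x + δ)
lucas-shift-coprime {d} δ x rank d∤2 d∣L[x] d∣L[x+δ] with lucas-divisor-rank x rank d∤2 d∣L[x]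
... | 2δ∣2x , 2δ∤x with *-cancelˡ-∣ {δ} {x} 2 2δ∣2x
... | divides q refl with even-multiple q δ
... | inj₁ 2δ∣qδ = 2δ∤x 2δ∣qδ
... | inj₂ 2δ∣[1+q]δ =
  proj₂ (lucas-divisor-rank (q * δ + δ) rank d∤2 d∣L[x+δ]) (subst (2 * δ ∣_) (+-comm δ (q * δ)) 2δ∣[1+q]δ)

-- p-adic valuations

0<m*n : ∀ {m n} → 0 < m → 0 < n → 0 < m * n
0<m*n {suc m} {suc n} _ _ = z<s

∤⇒pos : ∀ {p u} → ¬ p ∣ u → 0 < u
∤⇒pos {u = zero} p∤0 = ⊥-elim (p∤0 (divides 0 refl))
∤⇒pos {u = suc u} _ = z<s

∣⇒pos : ∀ {x y} → x ∣ y → 0 < y → 0 < x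
∣⇒pos {zero} (divides q refl) 0<y = ⊥-elim (<-irrefl (sym (*-zeroʳ q)) 0<y)
∣⇒pos {suc x} _ _ = z<s

prime⇒2≤ : ∀ {p} → Prime p → 2 ≤ p
prime⇒2≤ {p} p-prime = nonTrivial⇒n>1 p {{prime⇒nonTrivial p-prime}}

3-prime : Prime 3
3-prime = from-yes (prime? 3)

2≤3 : 2 ≤ 3
2≤3 = prime⇒2≤ 3-prime

0<p^ : ∀ {p} e → 2 ≤ p → 0 < p ^ e
0<p^ {p} e 2≤p = m^n>0 p {{>-nonZero (≤-trans z<s 2≤p)}} e

quotient-pos-< : ∀ {p q m} → 2 ≤ p → 0 < m → m ≡ q * p → 0 < q × q < m
quotient-pos-< {q = zero} _ 0<m refl = ⊥-elim (<-irrefl refl 0<m)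
quotient-pos-< {p} {suc q} 2≤p _ refl = z<s , subst (_< suc q * p) (*-identityʳ (suc q)) (*-monoʳ-< (suc q) 2≤p)

-- Fuel f ≥ m suffices, since each step divides by p ≥ 2; note the junk value ν p 0 = 0.
νFuel : ℕ → ℕ → ℕ → ℕ
νFuel p zero m = 0
νFuel p (suc f) m with p ∣? m
... | yes (divides q _) = suc (νFuel p f q)
... | no _ = 0

ν : ℕ → ℕ → ℕ
ν p m = νFuel p m m

νFuel-factor : ∀ p f m → 2 ≤ p → 0 < m → m ≤ f → ∃[ u ] m ≡ p ^ νFuel p f m * u × ¬ p ∣ u
νFuel-factor p zero m _ 0<m m≤0 = ⊥-elim (<-irrefl refl (≤-trans 0<m m≤0))
νFuel-factor p (suc f) m 2≤p 0<m m≤1+f with p ∣? m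
... | no p∤m = m , sym (+-identityʳ m) , p∤m
... | yes (divides q m≡qp) with quotient-pos-< 2≤p 0<m m≡qp
... | 0<q , q<m with νFuel-factor p f q 2≤p 0<q (≤-pred (≤-trans q<m m≤1+f))
... | u , q≡p^v*u , p∤u = u , trans m≡qp (trans (cong (_* p) q≡p^v*u) (rotate (p ^ νFuel p f q) u p)) , p∤u
  where
  rotate : ∀ a b c → a * b * c ≡ c * a * b
  rotate = solve-∀

ν-factor : ∀ p m → 2 ≤ p → 0 < m → ∃[ u ] m ≡ p ^ ν p m * u × ¬ p ∣ u
ν-factor p m 2≤p 0<m = νFuel-factor p m m 2≤p 0<m ≤-refl

pow-cofactor-unique : ∀ {p} e e' {u u'} → 2 ≤ p → p ^ e * u ≡ p ^ e' * u' → ¬ p ∣ u → ¬ p ∣ u' → e ≡ e'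
pow-cofactor-unique zero zero _ _ _ _ = refl
pow-cofactor-unique {p} zero (suc e') {u} {u'} _ eq p∤u _ =
  ⊥-elim (p∤u (divides (p ^ e' * u') (trans (sym (+-identityʳ u)) (trans eq (rotate p (p ^ e') u')))))
  where
  rotate : ∀ a b c → a * b * c ≡ b * c * a
  rotate = solve-∀
pow-cofactor-unique (suc e) zero 2≤p eq p∤u p∤u' = sym (pow-cofactor-unique zero (suc e) 2≤p (sym eq) p∤u' p∤u)
pow-cofactor-unique {p} (suc e) (suc e') {u} {u'} 2≤p eq p∤u p∤u' =
  cong suc (pow-cofactor-unique e e' 2≤p (*-cancelˡ-≡ _ _ p {{>-nonZero (≤-trans z<s 2≤p)}} eq') p∤u p∤u')
  where
  eq' : p * (p ^ e * u) ≡ p * (p ^ e' * u')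
  eq' = trans (sym (*-assoc p (p ^ e) u)) (trans eq (*-assoc p (p ^ e') u'))

ν-unique : ∀ {p m} e u → 2 ≤ p → m ≡ p ^ e * u → ¬ p ∣ u → ν p m ≡ e
ν-unique {p} {m} e u 2≤p m≡p^e*u p∤u with ν-factor p m 2≤p (subst (0 <_) (sym m≡p^e*u) (0<m*n (0<p^ e 2≤p) (∤⇒pos p∤u)))
... | w , m≡p^ν*w , p∤w = pow-cofactor-unique (ν p m) e 2≤p (trans (sym m≡p^ν*w) m≡p^e*u) p∤w p∤u

ν≡0 : ∀ {p m} → 2 ≤ p → ¬ p ∣ m → ν p m ≡ 0
ν≡0 {m = m} 2≤p p∤m = ν-unique 0 m 2≤p (sym (+-identityʳ m)) p∤m

p^ν∣ : ∀ {p m} → 2 ≤ p → 0 < m → p ^ ν p m ∣ m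
p^ν∣ {p} {m} 2≤p 0<m with ν-factor p m 2≤p 0<m
... | u , m≡p^ν*u , _ = divides u (trans m≡p^ν*u (*-comm _ u))

p^-mono-∣ : ∀ p {e f} → e ≤ f → p ^ e ∣ p ^ f
p^-mono-∣ p {e} e≤f with m≤n⇒∃[o]m+o≡n e≤f
... | d , refl = divides (p ^ d) (trans (^-distribˡ-+-* p e d) (*-comm (p ^ e) (p ^ d)))

≤ν⇒p^∣ : ∀ {p m e} → 2 ≤ p → 0 < m → e ≤ ν p m → p ^ e ∣ m
≤ν⇒p^∣ {p} 2≤p 0<m e≤ν = ∣-trans (p^-mono-∣ p e≤ν) (p^ν∣ 2≤p 0<m)

p^∣⇒≤ν : ∀ {p m e} → 2 ≤ p → 0 < m → p ^ e ∣ m → e ≤ ν p m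
p^∣⇒≤ν _ 0<m (divides zero refl) = ⊥-elim (<-irrefl refl 0<m)
p^∣⇒≤ν {p} {m} {e} 2≤p _ (divides q@(suc _) m≡q*p^e) with ν-factor p q 2≤p z<s
... | w , q≡p^v*w , p∤w = subst (e ≤_) (sym ν[m]≡e+v) (m≤m+n e _)
  where
  ν[m]≡e+v : ν p m ≡ e + ν p q
  ν[m]≡e+v = ν-unique (e + ν p q) w 2≤p (begin
    m                          ≡⟨ m≡q*p^e ⟩
    q * p ^ e                  ≡⟨ cong (_* p ^ e) q≡p^v*w ⟩
    p ^ ν p q * w * p ^ e      ≡⟨ rotate (p ^ ν p q) w (p ^ e) ⟩
    p ^ e * p ^ ν p q * w      ≡⟨ cong (_* w) (^-distribˡ-+-* p e (ν p q)) ⟨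
    p ^ (e + ν p q) * w        ∎) p∤w
    where
    open ≡-Reasoning
    rotate : ∀ a b c → a * b * c ≡ c * a * b
    rotate = solve-∀

∤p^suc⇒ν≤ : ∀ {p m e} → 2 ≤ p → 0 < m → ¬ p ^ suc e ∣ m → ν p m ≤ e
∤p^suc⇒ν≤ 2≤p 0<m p^[1+e]∤m = ≮⇒≥ (p^[1+e]∤m ∘ ≤ν⇒p^∣ 2≤p 0<m)

ν≢0⇒∣ : ∀ {p m} → 2 ≤ p → 0 < m → ν p m ≢ 0 → p ∣ m
ν≢0⇒∣ {p} 2≤p 0<m ν≢0 = subst (_∣ _) (*-identityʳ p) (≤ν⇒p^∣ 2≤p 0<m (n≢0⇒n>0 ν≢0))

ν-* : ∀ {p x y} → Prime p → 0 < x → 0 < y → ν p (x * y) ≡ ν p x + ν p y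
ν-* {p} {x} {y} p-prime 0<x 0<y with ν-factor p x 2≤p 0<x | ν-factor p y 2≤p 0<y
  where 2≤p = prime⇒2≤ p-prime
... | u , x≡ , p∤u | w , y≡ , p∤w = ν-unique (ν p x + ν p y) (u * w) (prime⇒2≤ p-prime) (begin
  x * y                                  ≡⟨ cong₂ _*_ x≡ y≡ ⟩
  p ^ ν p x * u * (p ^ ν p y * w)        ≡⟨ interchange (p ^ ν p x) u (p ^ ν p y) w ⟩
  p ^ ν p x * p ^ ν p y * (u * w)        ≡⟨ cong (_* (u * w)) (^-distribˡ-+-* p (ν p x) (ν p y)) ⟨
  p ^ (ν p x + ν p y) * (u * w)          ∎) p∤uw
  where
  open ≡-Reasoning
  interchange : ∀ a b c d → a * b * (c * d) ≡ a * c * (b * d)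
  interchange = solve-∀
  p∤uw : ¬ p ∣ u * w
  p∤uw p∣uw = [ p∤u , p∤w ] (euclidsLemma u w p-prime p∣uw)

ν-mono-∣ : ∀ {p x y} → 2 ≤ p → x ∣ y → 0 < y → ν p x ≤ ν p y
ν-mono-∣ 2≤p x∣y 0<y = p^∣⇒≤ν 2≤p 0<y (∣-trans (p^ν∣ 2≤p (∣⇒pos x∣y 0<y)) x∣y)

ν[p]p≡1 : ∀ {p} → 2 ≤ p → ν p p ≡ 1
ν[p]p≡1 {p} 2≤p = ν-unique 1 1 2≤p (sym (trans (*-identityʳ _) (*-identityʳ p)))
  (λ p∣1 → <-irrefl (sym (∣1⇒≡1 p∣1)) 2≤p)

ν₃[2*m] : ∀ m → 0 < m → ν 3 (2 * m) ≡ ν 3 m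
ν₃[2*m] m 0<m = trans (ν-* {3} {2} {m} 3-prime z<s 0<m) (cong (_+ ν 3 m) (ν≡0 2≤3 (from-no (3 ∣? 2))))

ν₃[3*m] : ∀ m → 0 < m → ν 3 (3 * m) ≡ suc (ν 3 m)
ν₃[3*m] m 0<m = trans (ν-* {3} {3} {m} 3-prime z<s 0<m) (cong (_+ ν 3 m) (ν[p]p≡1 2≤3))

prime-factor : ∀ x → 2 ≤ x → ∃[ p ] Prime p × p ∣ x
prime-factor (suc zero) (s≤s ())
prime-factor x@(suc (suc _)) _ with factorise x
... | record { factors = [] ; isFactorisation = () }
... | record { factors = p ∷ ps ; isFactorisation = x≡ ; factorsPrime = p-prime ∷ _ } =
  p , p-prime , divides (product ps) (trans x≡ (*-comm p _))

ν-≤-cancel-prime : ∀ {p x y} q → Prime p → Prime q → 0 < x → 0 < y →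
                   ν q (x * p) ≤ ν q (y * p) → ν q x ≤ ν q y
ν-≤-cancel-prime {p} {x} {y} q p-prime q-prime 0<x 0<y =
  +-cancelʳ-≤ (ν q p) (ν q x) (ν q y) ∘ subst₂ _≤_ (ν-* q-prime 0<x 0<p) (ν-* q-prime 0<y 0<p)
  where
  0<p = ≤-trans z<s (prime⇒2≤ p-prime)

ν-≤⇒∣ : ∀ x {y} → 0 < x → 0 < y → (∀ p → Prime p → ν p x ≤ ν p y) → x ∣ y
ν-≤⇒∣ = <-rec _ step
  where
  step : ∀ x → (∀ {x'} → x' < x → ∀ {y} → 0 < x' → 0 < y → (∀ p → Prime p → ν p x' ≤ ν p y) → x' ∣ y) →
         ∀ {y} → 0 < x → 0 < y → (∀ p → Prime p → ν p x ≤ ν p y) → x ∣ y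
  step (suc zero) _ _ _ _ = 1∣ _
  step x@(suc (suc _)) rec {y} 0<x 0<y ν≤ with prime-factor x (s≤s (s≤s z≤n))
  ... | p , p-prime , divides x' x≡x'p with ≤ν⇒p^∣ {e = 1} 2≤p 0<y 1≤ν[p]y
    where
    2≤p = prime⇒2≤ p-prime
    1≤ν[p]y : 1 ≤ ν p y
    1≤ν[p]y = ≤-trans (≤-reflexive (sym (ν[p]p≡1 2≤p))) (≤-trans (ν-mono-∣ 2≤p (divides x' x≡x'p) 0<x) (ν≤ p p-prime))
  ... | divides y' y≡y'p' = subst₂ _∣_ (sym x≡x'p) (sym y≡y'p) (*-monoˡ-∣ p (rec x'<x 0<x' 0<y' ν≤'))
    where
    2≤p = prime⇒2≤ p-prime
    y≡y'p : y ≡ y' * p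
    y≡y'p = trans y≡y'p' (cong (y' *_) (*-identityʳ p))
    0<x' = proj₁ (quotient-pos-< 2≤p 0<x x≡x'p)
    x'<x = proj₂ (quotient-pos-< 2≤p 0<x x≡x'p)
    0<y' = proj₁ (quotient-pos-< 2≤p 0<y y≡y'p)
    ν≤' : ∀ q → Prime q → ν q x' ≤ ν q y'
    ν≤' q q-prime = ν-≤-cancel-prime {p} {x'} {y'} q p-prime q-prime 0<x' 0<y'
      (subst₂ (λ a b → ν q a ≤ ν q b) x≡x'p y≡y'p (ν≤ q q-prime))

-- lcm a b divides p ^ M * (u * w), where u and w are the p-free parts of a and b.
ν-lcm≤ : ∀ {p a b M} → Prime p → 0 < a → 0 < b → ν p a ≤ M → ν p b ≤ M → ν p (lcm a b) ≤ M
ν-lcm≤ {p} {a} {b} {M} p-prime 0<a 0<b νa≤M νb≤M with ν-factor p a 2≤p 0<a | ν-factor p b 2≤p 0<b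
  where 2≤p = prime⇒2≤ p-prime
... | u , a≡ , p∤u | w , b≡ , p∤w = subst (ν p (lcm a b) ≤_) (ν-unique M (u * w) 2≤p refl p∤uw)
  (ν-mono-∣ 2≤p (lcm-least a∣N b∣N) (0<m*n (0<p^ M 2≤p) (0<m*n (∤⇒pos p∤u) (∤⇒pos p∤w))))
  where
  2≤p = prime⇒2≤ p-prime
  p∤uw : ¬ p ∣ u * w
  p∤uw p∣uw = [ p∤u , p∤w ] (euclidsLemma u w p-prime p∣uw)
  N = p ^ M * (u * w)
  a∣N : a ∣ N
  a∣N = subst (_∣ N) (sym a≡) (*-pres-∣ (p^-mono-∣ p νa≤M) (m∣m*n w))
  b∣N : b ∣ N
  b∣N = subst (_∣ N) (sym b≡) (*-pres-∣ (p^-mono-∣ p νb≤M) (n∣m*n u))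

-- Small prime divisors of Fibonacci and Lucas numbers

4∣2*m⇒m%4≡2 : ∀ m → 4 ∣ 2 * m → ¬ 4 ∣ m → m % 4 ≡ 2
4∣2*m⇒m%4≡2 m 4∣2m 4∤m with m % 4 in m%4≡r | m%n<n m 4 | trans (sym (%-distribˡ-* 2 m 4)) (n∣m⇒m%n≡0 _ 4 4∣2m)
... | 0 | _ | _ = ⊥-elim (4∤m (m%n≡0⇒n∣m m 4 m%4≡r))
... | 1 | _ | ()
... | 2 | _ | _ = refl
... | 3 | _ | ()
... | suc (suc (suc (suc _))) | s≤s (s≤s (s≤s (s≤s ()))) | _

3∣lucas⇒%4≡2 : ∀ m → 3 ∣ lucas m → m % 4 ≡ 2
3∣lucas⇒%4≡2 m 3∣L = uncurry (4∣2*m⇒m%4≡2 m) (lucas-divisor-rank m (from-yes (rank? 3 4)) (from-no (3 ∣? 2)) 3∣L)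

5∤lucas : ∀ m → ¬ 5 ∣ lucas m
5∤lucas m 5∣L with lucas-divisor-rank m (from-yes (rank? 5 5)) (from-no (5 ∣? 2)) 5∣L
... | 5∣2m , 5∤m with euclidsLemma 2 m (from-yes (prime? 5)) 5∣2m
... | inj₁ 5∣2 = from-no (5 ∣? 2) 5∣2
... | inj₂ 5∣m = 5∤m 5∣m

prime∣prime⇒≡ : ∀ {p q} → Prime p → Prime q → p ∣ q → p ≡ q
prime∣prime⇒≡ p-prime q-prime p∣q with prime⇒irreducible q-prime p∣q
... | inj₁ refl = ⊥-elim (<-irrefl refl (prime⇒2≤ p-prime))
... | inj₂ p≡q = p≡q

prime∣^⇒≡ : ∀ {p q} a → Prime p → Prime q → p ∣ q ^ a → p ≡ q
prime∣^⇒≡ zero p-prime _ p∣1 = ⊥-elim (<-irrefl (sym (∣1⇒≡1 p∣1)) (prime⇒2≤ p-prime))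
prime∣^⇒≡ {q = q} (suc a) p-prime q-prime p∣q^[1+a] with euclidsLemma q (q ^ a) p-prime p∣q^[1+a]
... | inj₁ p∣q = prime∣prime⇒≡ p-prime q-prime p∣q
... | inj₂ p∣q^a = prime∣^⇒≡ a p-prime q-prime p∣q^a

prime∣2^a*3^b : ∀ {p} a b → Prime p → p ∣ 2 ^ a * 3 ^ b → p ≡ 2 ⊎ p ≡ 3
prime∣2^a*3^b a b p-prime p∣ with euclidsLemma (2 ^ a) (3 ^ b) p-prime p∣
... | inj₁ p∣2^a = inj₁ (prime∣^⇒≡ a p-prime prime[2] p∣2^a)
... | inj₂ p∣3^b = inj₂ (prime∣^⇒≡ b p-prime 3-prime p∣3^b)

nearby-lucas-divisor∣fib : ∀ {d} x δ → d ∣ lucas x → d ∣ lucas (x + δ) → d ∣ fib (2 * δ)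
nearby-lucas-divisor∣fib {d} x δ d∣L[x] d∣L[x+δ] = fib-cancelˡ-∣ (2 * x) (2 * δ)
  (subst (λ y → d ∣ fib y) (*-distribˡ-+ 2 x δ) (∣-trans d∣L[x+δ] (lucas∣fib[2*m] (x + δ))))
  (∣-trans d∣L[x] (lucas∣fib[2*m] x))

-- p ∣ F_2δ ∈ {1, 3, 8, 21, 55, 144}; the primes 7 and 11 have ranks 8 and 10, and 5 ∤ L_x.
nearby-lucas-common-prime : ∀ {p} x δ → Prime p → 0 < δ → δ ≤ 6 → p ∣ lucas x → p ∣ lucas (x + δ) → p ≡ 2 ⊎ p ≡ 3
nearby-lucas-common-prime x 1 p-prime _ _ p∣L p∣L' = prime∣2^a*3^b 0 0 p-prime (nearby-lucas-divisor∣fib x 1 p∣L p∣L')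
nearby-lucas-common-prime x 2 p-prime _ _ p∣L p∣L' = prime∣2^a*3^b 0 1 p-prime (nearby-lucas-divisor∣fib x 2 p∣L p∣L')
nearby-lucas-common-prime x 3 p-prime _ _ p∣L p∣L' = prime∣2^a*3^b 3 0 p-prime (nearby-lucas-divisor∣fib x 3 p∣L p∣L')
nearby-lucas-common-prime x 6 p-prime _ _ p∣L p∣L' = prime∣2^a*3^b 4 2 p-prime (nearby-lucas-divisor∣fib x 6 p∣L p∣L')
nearby-lucas-common-prime x 4 p-prime _ _ p∣L p∣L' with euclidsLemma 3 7 p-prime (nearby-lucas-divisor∣fib x 4 p∣L p∣L')
... | inj₁ p∣3 = inj₂ (prime∣prime⇒≡ p-prime 3-prime p∣3)
... | inj₂ p∣7 with prime∣prime⇒≡ p-prime (from-yes (prime? 7)) p∣7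
... | refl = ⊥-elim (lucas-shift-coprime 4 x (from-yes (rank? 7 8)) (from-no (7 ∣? 2)) p∣L p∣L')
nearby-lucas-common-prime x 5 p-prime _ _ p∣L p∣L' with euclidsLemma 5 11 p-prime (nearby-lucas-divisor∣fib x 5 p∣L p∣L')
... | inj₁ p∣5 with prime∣prime⇒≡ p-prime (from-yes (prime? 5)) p∣5
... | refl = ⊥-elim (5∤lucas x p∣L)
nearby-lucas-common-prime x 5 p-prime _ _ p∣L p∣L' | inj₂ p∣11 with prime∣prime⇒≡ p-prime (from-yes (prime? 11)) p∣11
... | refl = ⊥-elim (lucas-shift-coprime 5 x (from-yes (rank? 11 10)) (from-no (11 ∣? 2)) p∣L p∣L')
nearby-lucas-common-prime x (suc (suc (suc (suc (suc (suc (suc _))))))) _ _ (s≤s (s≤s (s≤s (s≤s (s≤s (s≤s ())))))) _ _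

2∣lucas⇒3∣ : ∀ m → 2 ∣ lucas m → 3 ∣ m
2∣lucas⇒3∣ m 2∣L with euclidsLemma 2 m 3-prime (rank∣ (from-yes (rank? 2 3)) (∣-trans 2∣L (lucas∣fib[2*m] m)))
... | inj₁ 3∣2 = ⊥-elim (from-no (3 ∣? 2) 3∣2)
... | inj₂ 3∣m = 3∣m

4∣lucas⇒6∤ : ∀ m → 4 ∣ lucas m → ¬ 6 ∣ m
4∣lucas⇒6∤ m 4∣L 6∣m = from-no (4 ∣? 2) (∣lucas∧∣fib⇒∣2 m 4∣L (∣-trans (divides 2 refl) (∣⇒fib∣fib 6∣m)))

-- If 8 ∣ L_m then 3 ∣ m, so 2 = F_3 ∣ F_m and 16 ∣ F_m L_m = F_2m, whence 12 ∣ 2m.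
8∤lucas : ∀ m → ¬ 8 ∣ lucas m
8∤lucas m 8∣L = 4∣lucas⇒6∤ m (∣-trans (divides 2 refl) 8∣L) (*-cancelˡ-∣ {6} {m} 2 (rank∣ (from-yes (rank? 16 12)) 16∣F[2m]))
  where
  16∣F[2m] : 16 ∣ fib (2 * m)
  16∣F[2m] = subst (16 ∣_) (sym (fib[2*m]≡fib[m]*lucas[m] m))
    (*-pres-∣ (∣⇒fib∣fib (2∣lucas⇒3∣ m (∣-trans (divides 4 refl) 8∣L))) 8∣L)

ν₂-lucas-bound : ℕ → ℕ
ν₂-lucas-bound 0 = 1
ν₂-lucas-bound 3 = 2
ν₂-lucas-bound _ = 0

ν₂-lucas≤ : ∀ m → ν 2 (lucas m) ≤ ν₂-lucas-bound (m % 6)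
ν₂-lucas≤ m = bound (m % 6) refl (m%n<n m 6)
  where
  2≤2 : 2 ≤ 2
  2≤2 = ≤-refl
  odd : ∀ {r} → m % 6 ≡ r → ¬ r % 3 ≡ 0 → ν 2 (lucas m) ≤ 0
  odd refl m%6%3≢0 = ∤p^suc⇒ν≤ 2≤2 (lucas-pos m) λ 2∣L → m%6%3≢0
    (trans (m∣n⇒o%n%m≡o%m 3 6 m (divides 2 refl)) (n∣m⇒m%n≡0 m 3 (2∣lucas⇒3∣ m (∣-trans (divides 1 refl) 2∣L))))
  bound : ∀ r → m % 6 ≡ r → r < 6 → ν 2 (lucas m) ≤ ν₂-lucas-bound r
  bound 0 m%6≡0 _ = ∤p^suc⇒ν≤ 2≤2 (lucas-pos m) (λ 4∣L → 4∣lucas⇒6∤ m 4∣L (m%n≡0⇒n∣m m 6 m%6≡0))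
  bound 1 m%6≡1 _ = odd m%6≡1 λ ()
  bound 2 m%6≡2 _ = odd m%6≡2 λ ()
  bound 3 _ _ = ∤p^suc⇒ν≤ 2≤2 (lucas-pos m) (8∤lucas m)
  bound 4 m%6≡4 _ = odd m%6≡4 λ ()
  bound 5 m%6≡5 _ = odd m%6≡5 λ ()
  bound (suc (suc (suc (suc (suc (suc _)))))) _ (s≤s (s≤s (s≤s (s≤s (s≤s (s≤s ()))))))

3∣fib⇒3∤neighbours : ∀ k → 3 ∣ fib (suc k) → ¬ 3 ∣ fib (suc (suc k)) * fib k
3∣fib⇒3∤neighbours k 3∣F 3∣F₂F₀ with euclidsLemma (fib (suc (suc k))) (fib k) 3-prime 3∣F₂F₀
... | inj₁ 3∣F₂ = from-no (3 ∣? 1) (subst (3 ∣_) (fib-coprime-suc (suc k) (3∣F , 3∣F₂)) ∣-refl)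
... | inj₂ 3∣F₀ = from-no (3 ∣? 1) (subst (3 ∣_) (fib-coprime-suc k (3∣F₀ , 3∣F)) ∣-refl)

-- With F_m = 3s the cofactor in fib[3*m] is 3 (F_(m+1) F_(m-1) + 6 s²), and 3 ∤ F_(m+1) F_(m-1).
ν₃-fib-triple : ∀ m → 0 < m → 3 ∣ fib m → ν 3 (fib (3 * m)) ≡ suc (ν 3 (fib m))
ν₃-fib-triple (suc k) _ 3∣F@(divides s F≡s*3) = begin
  ν 3 (fib (3 * suc k))                ≡⟨ cong (ν 3) (fib[3*m] k) ⟩
  ν 3 (fib (suc k) * X)                ≡⟨ ν-* 3-prime (fib-pos k) (subst (0 <_) (sym X≡Y*3) (0<m*n (∤⇒pos 3∤Y) z<s)) ⟩
  ν 3 (fib (suc k)) + ν 3 X            ≡⟨ cong (ν 3 (fib (suc k)) +_) ν₃X≡1 ⟩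
  ν 3 (fib (suc k)) + 1                ≡⟨ +-comm _ 1 ⟩
  suc (ν 3 (fib (suc k)))              ∎
  where
  open ≡-Reasoning
  F₂F₀ = fib (suc (suc k)) * fib k
  X = 3 * fib (suc (suc k)) * fib k + 2 * (fib (suc k) * fib (suc k))
  Y = F₂F₀ + 3 * (2 * (s * s))
  X≡Y*3 : X ≡ Y * 3
  X≡Y*3 = trans (cong (λ f → 3 * fib (suc (suc k)) * fib k + 2 * (f * f)) F≡s*3)
                (regroup (fib (suc (suc k))) (fib k) s)
    where
    regroup : ∀ a b s → 3 * a * b + 2 * (s * 3 * (s * 3)) ≡ (a * b + 3 * (2 * (s * s))) * 3
    regroup = solve-∀
  3∤Y : ¬ 3 ∣ Y
  3∤Y 3∣Y = 3∣fib⇒3∤neighbours k 3∣F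
    (∣m+n∣m⇒∣n (subst (3 ∣_) (+-comm F₂F₀ _) 3∣Y) (divides (2 * (s * s)) (*-comm 3 (2 * (s * s)))))
  ν₃X≡1 : ν 3 X ≡ 1
  ν₃X≡1 = ν-unique 1 Y 2≤3 (trans X≡Y*3 (trans (*-comm Y 3) (cong (_* Y) (sym (*-identityʳ 3))))) 3∤Y

ν₃-fib : ∀ c → 0 < c → 4 ∣ c → ν 3 (fib c) ≡ suc (ν 3 c)
ν₃-fib c 0<c 4∣c = go (ν 3 c) c refl 0<c 4∣c
  where
  3∣fib : ∀ {c} → 4 ∣ c → 3 ∣ fib c
  3∣fib 4∣c = ∣⇒fib∣fib 4∣c
  go : ∀ v c → ν 3 c ≡ v → 0 < c → 4 ∣ c → ν 3 (fib c) ≡ suc v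
  go zero c ν₃c≡0 0<c 4∣c with 3∣fib 4∣c
  ... | divides s F≡s*3 = ν-unique 1 s 2≤3 (trans F≡s*3 (trans (*-comm s 3) (cong (_* s) (sym (*-identityʳ 3))))) 3∤s
    where
    3∤c : ¬ 3 ∣ c
    3∤c 3∣c = <-irrefl (sym ν₃c≡0) (p^∣⇒≤ν {e = 1} 2≤3 0<c (subst (_∣ c) (sym (*-identityʳ 3)) 3∣c))
    3∤s : ¬ 3 ∣ s
    3∤s 3∣s = 3∤c (∣-trans (divides 4 refl) (rank∣ (from-yes (rank? 9 12)) (subst (9 ∣_) (sym F≡s*3) (*-monoˡ-∣ 3 3∣s))))
  go (suc v) c ν₃c≡1+v 0<c 4∣c with ≤ν⇒p^∣ {e = 1} 2≤3 0<c (subst (1 ≤_) (sym ν₃c≡1+v) (s≤s z≤n))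
  ... | divides c' c≡c'*3¹ = begin
    ν 3 (fib c)              ≡⟨ cong (λ x → ν 3 (fib x)) c≡3*c' ⟩
    ν 3 (fib (3 * c'))       ≡⟨ ν₃-fib-triple c' 0<c' (3∣fib 4∣c') ⟩
    suc (ν 3 (fib c'))       ≡⟨ cong suc (go v c' ν₃c'≡v 0<c' 4∣c') ⟩
    suc (suc v)              ∎
    where
    open ≡-Reasoning
    c≡3*c' : c ≡ 3 * c'
    c≡3*c' = trans c≡c'*3¹ (trans (cong (c' *_) (*-identityʳ 3)) (*-comm c' 3))
    0<c' : 0 < c'
    0<c' = proj₁ (quotient-pos-< 2≤3 0<c (trans c≡3*c' (*-comm 3 c')))
    4∣c' : 4 ∣ c'
    4∣c' = coprime-divisor (from-yes (coprime? 4 3)) (subst (4 ∣_) c≡3*c' 4∣c)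
    ν₃c'≡v : ν 3 c' ≡ v
    ν₃c'≡v = suc-injective (trans (sym (ν₃[3*m] c' 0<c')) (trans (cong (ν 3) (sym c≡3*c')) ν₃c≡1+v))

m%4≡2⇒4∣2*m : ∀ m → m % 4 ≡ 2 → 4 ∣ 2 * m
m%4≡2⇒4∣2*m m m%4≡2 = divides (1 + 2 * (m / 4)) (begin
  2 * m                        ≡⟨ cong (2 *_) (trans (m≡m%n+[m/n]*n m 4) (cong (_+ m / 4 * 4) m%4≡2)) ⟩
  2 * (2 + m / 4 * 4)          ≡⟨ regroup (m / 4) ⟩
  (1 + 2 * (m / 4)) * 4        ∎)
  where
  open ≡-Reasoning
  regroup : ∀ q → 2 * (2 + q * 4) ≡ (1 + 2 * q) * 4
  regroup = solve-∀

ν₃-lucas : ∀ m → m % 4 ≡ 2 → ν 3 (lucas m) ≡ suc (ν 3 m)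
ν₃-lucas zero ()
ν₃-lucas m@(suc m-1) m%4≡2 = begin
  ν 3 (lucas m)                   ≡⟨ cong (_+ ν 3 (lucas m)) ν₃F≡0 ⟨
  ν 3 (fib m) + ν 3 (lucas m)     ≡⟨ ν-* 3-prime (fib-pos m-1) (lucas-pos m) ⟨
  ν 3 (fib m * lucas m)           ≡⟨ cong (ν 3) (fib[2*m]≡fib[m]*lucas[m] m) ⟨
  ν 3 (fib (2 * m))               ≡⟨ ν₃-fib (2 * m) z<s (m%4≡2⇒4∣2*m m m%4≡2) ⟩
  suc (ν 3 (2 * m))               ≡⟨ cong suc (ν₃[2*m] m z<s) ⟩
  suc (ν 3 m)                     ∎
  where
  open ≡-Reasoning
  ν₃F≡0 : ν 3 (fib m) ≡ 0
  ν₃F≡0 = ν≡0 2≤3 λ 3∣F → contradiction (trans (sym (n∣m⇒m%n≡0 m 4 (rank∣ (from-yes (rank? 3 4)) 3∣F))) m%4≡2) λ ()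

ν₃-lucas≡0 : ∀ m → ¬ m % 4 ≡ 2 → ν 3 (lucas m) ≡ 0
ν₃-lucas≡0 m m%4≢2 = ν≡0 2≤3 (m%4≢2 ∘ 3∣lucas⇒%4≡2 m)

ν₃-small : ℕ → ℕ
ν₃-small 3 = 1
ν₃-small 6 = 1
ν₃-small _ = 0

ν₃-small≤1 : ∀ j → ν₃-small j ≤ 1
ν₃-small≤1 0 = z≤n
ν₃-small≤1 1 = z≤n
ν₃-small≤1 2 = z≤n
ν₃-small≤1 3 = ≤-refl
ν₃-small≤1 4 = z≤n
ν₃-small≤1 5 = z≤n
ν₃-small≤1 6 = ≤-refl
ν₃-small≤1 (suc (suc (suc (suc (suc (suc (suc _))))))) = z≤n

ν₃-by-%9 : ∀ m → ¬ 9 ∣ m → ν 3 m ≡ ν₃-small (m % 9)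
ν₃-by-%9 m 9∤m = by-residue (m % 9) refl (m%n<n m 9)
  where
  m≡ : ∀ {j} → m % 9 ≡ j → m ≡ j + m / 9 * 9
  m≡ m%9≡j = trans (m≡m%n+[m/n]*n m 9) (cong (_+ m / 9 * 9) m%9≡j)
  coprime : ∀ {j} → m % 9 ≡ j → ¬ j % 3 ≡ 0 → ν 3 m ≡ 0
  coprime refl m%9%3≢0 = ν≡0 2≤3 λ 3∣m → m%9%3≢0 (trans (m∣n⇒o%n%m≡o%m 3 9 m (divides 3 refl)) (n∣m⇒m%n≡0 m 3 3∣m))
  exactly-3 : ∀ c → ¬ 3 ∣ c → m ≡ 3 * c + m / 9 * 9 → ν 3 m ≡ 1
  exactly-3 c 3∤c m≡3c+9q = ν-unique 1 (c + m / 9 * 3) 2≤3 (trans m≡3c+9q (regroup c (m / 9)))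
    (λ 3∣ → 3∤c (∣m+n∣m⇒∣n (subst (3 ∣_) (+-comm c _) 3∣) (divides (m / 9) refl)))
    where
    regroup : ∀ c q → 3 * c + q * 9 ≡ (3 * 1) * (c + q * 3)
    regroup = solve-∀
  by-residue : ∀ j → m % 9 ≡ j → j < 9 → ν 3 m ≡ ν₃-small j
  by-residue 0 m%9≡0 _ = ⊥-elim (9∤m (m%n≡0⇒n∣m m 9 m%9≡0))
  by-residue 1 m%9≡1 _ = coprime m%9≡1 λ ()
  by-residue 2 m%9≡2 _ = coprime m%9≡2 λ ()
  by-residue 3 m%9≡3 _ = exactly-3 1 (from-no (3 ∣? 1)) (m≡ m%9≡3)
  by-residue 4 m%9≡4 _ = coprime m%9≡4 λ ()
  by-residue 5 m%9≡5 _ = coprime m%9≡5 λ ()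
  by-residue 6 m%9≡6 _ = exactly-3 2 (from-no (3 ∣? 2)) (m≡ m%9≡6)
  by-residue 7 m%9≡7 _ = coprime m%9≡7 λ ()
  by-residue 8 m%9≡8 _ = coprime m%9≡8 λ ()
  by-residue (suc (suc (suc (suc (suc (suc (suc (suc (suc _))))))))) _ (s≤s (s≤s (s≤s (s≤s (s≤s (s≤s (s≤s (s≤s (s≤s ())))))))))

-- Blocks of consecutive integers

sum≤ : ℕ → (ℕ → ℕ) → ℕ
sum≤ zero f = f 0
sum≤ (suc k) f = sum≤ k f + f (suc k)

sum≤-mono-≤ : ∀ k {f g} → (∀ i → i ≤ k → f i ≤ g i) → sum≤ k f ≤ sum≤ k g
sum≤-mono-≤ zero f≤g = f≤g 0 z≤n
sum≤-mono-≤ (suc k) f≤g = +-mono-≤ (sum≤-mono-≤ k (λ i i≤k → f≤g i (m≤n⇒m≤1+n i≤k))) (f≤g (suc k) ≤-refl)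

sum≤-affine : ∀ k {f a b} B → (∀ i → i ≤ k → f i ≡ a i * B + b i) → sum≤ k f ≡ sum≤ k a * B + sum≤ k b
sum≤-affine zero B f≡ = f≡ 0 z≤n
sum≤-affine (suc k) {f} {a} {b} B f≡ =
  trans (cong₂ _+_ (sum≤-affine k B (λ i i≤k → f≡ i (m≤n⇒m≤1+n i≤k))) (f≡ (suc k) ≤-refl))
        (regroup (sum≤ k a) (a (suc k)) B (sum≤ k b) (b (suc k)))
  where
  regroup : ∀ x y B u v → (x * B + u) + (y * B + v) ≡ (x + y) * B + (u + v)
  regroup = solve-∀

sum≤-zero : ∀ k {f} → (∀ i → i ≤ k → f i ≡ 0) → sum≤ k f ≡ 0
sum≤-zero zero f≡0 = f≡0 0 z≤n
sum≤-zero (suc k) f≡0 = cong₂ _+_ (sum≤-zero k (λ i i≤k → f≡0 i (m≤n⇒m≤1+n i≤k))) (f≡0 (suc k) ≤-refl)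

sum≤-≤-sparse : ∀ k {f M} → (∀ i → i ≤ k → f i ≤ M) → (∀ i j → i < j → j ≤ k → f i ≡ 0 ⊎ f j ≡ 0) →
                sum≤ k f ≤ M
sum≤-≤-sparse zero f≤M _ = f≤M 0 z≤n
sum≤-≤-sparse (suc k) {f} {M} f≤M sparse with f (suc k) in f[1+k]≡
... | zero = subst (_≤ M) (sym (+-identityʳ _))
      (sum≤-≤-sparse k (λ i i≤k → f≤M i (m≤n⇒m≤1+n i≤k)) (λ i j i<j j≤k → sparse i j i<j (m≤n⇒m≤1+n j≤k)))
... | suc x = subst (_≤ M) (cong (_+ suc x) (sym (sum≤-zero k others-zero))) (subst (_≤ M) f[1+k]≡ (f≤M (suc k) ≤-refl))
  where
  others-zero : ∀ i → i ≤ k → f i ≡ 0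
  others-zero i i≤k with sparse i (suc k) (s≤s i≤k) ≤-refl
  ... | inj₁ f[i]≡0 = f[i]≡0
  ... | inj₂ f[1+k]≡0 with trans (sym f[1+k]≡) f[1+k]≡0
  ... | ()

max≤ : ℕ → (ℕ → ℕ) → ℕ
max≤ zero f = f 0
max≤ (suc k) f = max≤ k f ⊔ f (suc k)

max≤-least : ∀ k {f V} → (∀ i → i ≤ k → f i ≤ V) → max≤ k f ≤ V
max≤-least zero f≤V = f≤V 0 z≤n
max≤-least (suc k) f≤V = ⊔-lub (max≤-least k (λ i i≤k → f≤V i (m≤n⇒m≤1+n i≤k))) (f≤V (suc k) ≤-refl)

max≤-upper : ∀ k {f} i → i ≤ k → f i ≤ max≤ k f
max≤-upper zero zero _ = ≤-refl
max≤-upper (suc k) {f} i i≤1+k with m≤n⇒m<n∨m≡n i≤1+k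
... | inj₂ refl = m≤n⊔m (max≤ k f) (f (suc k))
... | inj₁ i<1+k = ≤-trans (max≤-upper k i (≤-pred i<1+k)) (m≤m⊔n (max≤ k f) (f (suc k)))

offset : ∀ m .{{_ : NonZero m}} → ℕ → ℕ
offset m n = (m ∸ n % m) % m

offset<m : ∀ m n .{{_ : NonZero m}} → offset m n < m
offset<m m n = m%n<n (m ∸ n % m) m

∣n+offset : ∀ m n .{{_ : NonZero m}} → m ∣ n + offset m n
∣n+offset m n = m%n≡0⇒n∣m (n + offset m n) m (begin
  (n + offset m n) % m                      ≡⟨ %-distribˡ-+ n (offset m n) m ⟩
  (n % m + offset m n % m) % m              ≡⟨ cong (λ x → (x + offset m n % m) % m) (m%n%n≡m%n n m) ⟨
  (n % m % m + (m ∸ n % m) % m % m) % m     ≡⟨ cong (λ x → (n % m % m + x) % m) (m%n%n≡m%n (m ∸ n % m) m) ⟩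
  (n % m % m + (m ∸ n % m) % m) % m         ≡⟨ %-distribˡ-+ (n % m) (m ∸ n % m) m ⟨
  (n % m + (m ∸ n % m)) % m                 ≡⟨ cong (_% m) (m+[n∸m]≡n (m%n≤n n m)) ⟩
  m % m                                     ≡⟨ n%n≡0 m ⟩
  0                                         ∎)
  where open ≡-Reasoning

offset-% : ∀ d m n .{{_ : NonZero d}} .{{_ : NonZero m}} → d ∣ m → offset d n ≡ offset d (n % m)
offset-% d m n d∣m = cong (λ x → (d ∸ x) % d) (sym (m∣n⇒o%n%m≡o%m d m n d∣m))

∣-gap : ∀ {m n i j} → i < j → j < m → m ∣ n + i → ¬ m ∣ n + j
∣-gap {m} {n} {i} {j} i<j j<m m∣n+i m∣n+j = <⇒≱ j<m (≤-trans (∣⇒≤ {{>-nonZero (m<n⇒0<n∸m i<j)}} m∣j∸i) (m∸n≤m j i))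
  where
  m∣j∸i : m ∣ j ∸ i
  m∣j∸i = ∣m+n∣m⇒∣n (subst (m ∣_) (trans (cong (n +_) (sym (m+[n∸m]≡n (<⇒≤ i<j)))) (sym (+-assoc n i _))) m∣n+j) m∣n+i

offset-unique : ∀ {m n i j} → m ∣ n + i → m ∣ n + j → i < m → j < m → i ≡ j
offset-unique {i = i} {j} m∣n+i m∣n+j i<m j<m with <-cmp i j
... | tri< i<j _ _ = ⊥-elim (∣-gap i<j j<m m∣n+i m∣n+j)
... | tri≈ _ i≡j _ = i≡j
... | tri> _ _ j<i = ⊥-elim (∣-gap j<i i<m m∣n+j m∣n+i)

[n+i]%d≡[n%m+i]%d : ∀ d m n i .{{_ : NonZero d}} .{{_ : NonZero m}} → d ∣ m → (n + i) % d ≡ (n % m + i) % d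
[n+i]%d≡[n%m+i]%d d m n i d∣m = begin
  (n + i) % d               ≡⟨ m∣n⇒o%n%m≡o%m d m (n + i) d∣m ⟨
  (n + i) % m % d           ≡⟨ cong (_% d) [n+i]%m≡[n%m+i]%m ⟩
  (n % m + i) % m % d       ≡⟨ m∣n⇒o%n%m≡o%m d m (n % m + i) d∣m ⟩
  (n % m + i) % d           ∎
  where
  open ≡-Reasoning
  [n+i]%m≡[n%m+i]%m : (n + i) % m ≡ (n % m + i) % m
  [n+i]%m≡[n%m+i]%m = trans (%-distribˡ-+ n i m)
    (trans (cong (λ x → (x + i % m) % m) (sym (m%n%n≡m%n n m))) (sym (%-distribˡ-+ (n % m) i m)))

n+i∣lcmRange : ∀ n k i → i ≤ k → n + i ∣ lcmRange n k
n+i∣lcmRange n zero zero _ = subst (_∣ n) (sym (+-identityʳ n)) ∣-refl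
n+i∣lcmRange n (suc k) i i≤1+k with m≤n⇒m<n∨m≡n i≤1+k
... | inj₂ refl = n∣lcm[m,n] (lcmRange n k) (n + suc k)
... | inj₁ i<1+k = ∣-trans (n+i∣lcmRange n k i (≤-pred i<1+k)) (m∣lcm[m,n] (lcmRange n k) (n + suc k))

lcmRange-least : ∀ n k {c} → (∀ i → i ≤ k → n + i ∣ c) → lcmRange n k ∣ c
lcmRange-least n zero n+i∣c = subst (_∣ _) (+-identityʳ n) (n+i∣c 0 z≤n)
lcmRange-least n (suc k) n+i∣c = lcm-least (lcmRange-least n k (λ i i≤k → n+i∣c i (m≤n⇒m≤1+n i≤k))) (n+i∣c (suc k) ≤-refl)

lcm-pos : ∀ {a b} → 0 < a → 0 < b → 0 < lcm a b
lcm-pos {a} {b} 0<a 0<b with lcm a b | gcd*lcm a b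
... | zero  | gcd*0≡ab = ⊥-elim (<-irrefl (trans (sym (*-zeroʳ (gcd a b))) gcd*0≡ab) (0<m*n 0<a 0<b))
... | suc _ | _ = z<s

lcmRange-pos : ∀ {n} k → 0 < n → 0 < lcmRange n k
lcmRange-pos zero 0<n = 0<n
lcmRange-pos (suc k) 0<n = lcm-pos (lcmRange-pos k 0<n) (≤-trans 0<n (m≤m+n _ _))

ν-lcmRange≤ : ∀ {p n M} k → Prime p → 0 < n → (∀ i → i ≤ k → ν p (n + i) ≤ M) → ν p (lcmRange n k) ≤ M
ν-lcmRange≤ {p} {n} {M} zero _ _ ν≤M = subst (λ x → ν p x ≤ M) (+-identityʳ n) (ν≤M 0 z≤n)
ν-lcmRange≤ (suc k) p-prime 0<n ν≤M = ν-lcm≤ p-prime (lcmRange-pos k 0<n) (≤-trans 0<n (m≤m+n _ _))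
  (ν-lcmRange≤ k p-prime 0<n (λ i i≤k → ν≤M i (m≤n⇒m≤1+n i≤k))) (ν≤M (suc k) ≤-refl)

∣lcmRange : ∀ n k m .{{_ : NonZero m}} → m ≤ suc k → m ∣ lcmRange n k
∣lcmRange n k m m≤1+k = ∣-trans (∣n+offset m n) (n+i∣lcmRange n k (offset m n) (≤-pred (≤-trans (offset<m m n) m≤1+k)))

lucasProd-pos : ∀ n k → 0 < lucasProd n k
lucasProd-pos n zero = lucas-pos n
lucasProd-pos n (suc k) = 0<m*n (lucasProd-pos n k) (lucas-pos (n + suc k))

lucas∣lucasProd : ∀ n k i → i ≤ k → lucas (n + i) ∣ lucasProd n k
lucas∣lucasProd n zero zero _ = subst (λ x → lucas x ∣ lucas n) (sym (+-identityʳ n)) ∣-refl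
lucas∣lucasProd n (suc k) i i≤1+k with m≤n⇒m<n∨m≡n i≤1+k
... | inj₂ refl = n∣m*n (lucasProd n k)
... | inj₁ i<1+k = ∣m⇒∣m*n (lucas (n + suc k)) (lucas∣lucasProd n k i (≤-pred i<1+k))

ν-lucasProd : ∀ {p} n k → Prime p → ν p (lucasProd n k) ≡ sum≤ k (λ i → ν p (lucas (n + i)))
ν-lucasProd {p} n zero _ = cong (λ x → ν p (lucas x)) (sym (+-identityʳ n))
ν-lucasProd {p} n (suc k) p-prime =
  trans (ν-* p-prime (lucasProd-pos n k) (lucas-pos (n + suc k))) (cong (_+ ν p (lucas (n + suc k))) (ν-lucasProd n k p-prime))

lucasProd∣fib⇒∣ : ∀ n k {j} → 1 ≤ n → 1 ≤ k → lucasProd n k ∣ fib j → 2 * lcmRange n k ∣ j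
lucasProd∣fib⇒∣ n k {j} 1≤n 1≤k b∣F[j] =
  a∣j (∣-trans (m∣m*n {2} (n + 1)) (rank∣ (lucas-rank (n + 1) (+-monoˡ-≤ 1 1≤n)) (L∣F 1 1≤k)))
  where
  L∣F : ∀ i → i ≤ k → lucas (n + i) ∣ fib j
  L∣F i i≤k = ∣-trans (lucas∣lucasProd n k i i≤k) b∣F[j]
  a∣j : 2 ∣ j → 2 * lcmRange n k ∣ j
  a∣j (divides j' j≡j'*2) = subst (2 * lcmRange n k ∣_) (trans (*-comm 2 j') (sym j≡j'*2)) (*-monoʳ-∣ 2 (lcmRange-least n k n+i∣j'))
    where
    n+i∣j' : ∀ i → i ≤ k → n + i ∣ j'
    n+i∣j' i i≤k with 2 ≤? n + i
    ... | yes 2≤n+i = *-cancelˡ-∣ 2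
      (subst (2 * (n + i) ∣_) (trans j≡j'*2 (*-comm j' 2)) (rank∣ (lucas-rank (n + i) 2≤n+i) (L∣F i i≤k)))
    ... | no 2≰n+i = subst (_∣ j') (≤-antisym (≤-trans 1≤n (m≤m+n n i)) (≤-pred (≰⇒> 2≰n+i))) (1∣ j')

ν₂-lucasProd≤ : ∀ n k → ν 2 (lucasProd n k) ≤ sum≤ k (λ i → ν₂-lucas-bound ((n + i) % 6))
ν₂-lucasProd≤ n k = subst (_≤ sum≤ k (λ i → ν₂-lucas-bound ((n + i) % 6))) (sym (ν-lucasProd n k prime[2]))
  (sum≤-mono-≤ k (λ i _ → ν₂-lucas≤ (n + i)))

ν-lucasProd≤ : ∀ {p M} n k → Prime p → p ≢ 2 → p ≢ 3 → k ≤ 6 →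
               (∀ i → i ≤ k → ν p (lucas (n + i)) ≤ M) → ν p (lucasProd n k) ≤ M
ν-lucasProd≤ {p} {M} n k p-prime p≢2 p≢3 k≤6 ν≤M =
  subst (_≤ M) (sym (ν-lucasProd n k p-prime)) (sum≤-≤-sparse k ν≤M sparse)
  where
  2≤p = prime⇒2≤ p-prime
  sparse : ∀ i j → i < j → j ≤ k → ν p (lucas (n + i)) ≡ 0 ⊎ ν p (lucas (n + j)) ≡ 0
  sparse i j i<j j≤k with ν p (lucas (n + i)) ≟ 0 | ν p (lucas (n + j)) ≟ 0
  ... | yes ν≡0 | _ = inj₁ ν≡0
  ... | no _ | yes ν≡0 = inj₂ ν≡0
  ... | no νi≢0 | no νj≢0 = ⊥-elim ([ p≢2 , p≢3 ] (nearby-lucas-common-prime (n + i) (j ∸ i) p-prime (m<n⇒0<n∸m i<j)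
        (≤-trans (m∸n≤m j i) (≤-trans j≤k k≤6)) (ν≢0⇒∣ 2≤p (lucas-pos (n + i)) νi≢0) p∣L[n+i+δ]))
    where
    p∣L[n+i+δ] : p ∣ lucas (n + i + (j ∸ i))
    p∣L[n+i+δ] = subst (λ x → p ∣ lucas x) (trans (cong (n +_) (sym (m+[n∸m]≡n (<⇒≤ i<j)))) (sym (+-assoc n i _)))
      (ν≢0⇒∣ 2≤p (lucas-pos (n + j)) νj≢0)

lucasProd∣fib : ∀ n k {c} → k ≤ 6 → 0 < c → 24 ∣ c → 2 * lcmRange n k ∣ c →
                sum≤ k (λ i → ν₂-lucas-bound ((n + i) % 6)) ≤ 5 → ν 3 (lucasProd n k) ≤ suc (ν 3 c) →
                lucasProd n k ∣ fib c
lucasProd∣fib n k {c} k≤6 0<c 24∣c a∣c ν₂-bound ν₃-bound = ν-≤⇒∣ _ (lucasProd-pos n k) 0<F ν≤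
  where
  0<F : 0 < fib c
  0<F = 0<fib 0<c
  L∣F : ∀ i → i ≤ k → lucas (n + i) ∣ fib c
  L∣F i i≤k = ∣-trans (lucas∣fib[2*m] (n + i)) (∣⇒fib∣fib (∣-trans (*-monoʳ-∣ 2 (n+i∣lcmRange n k i i≤k)) a∣c))
  ν≤ : ∀ p → Prime p → ν p (lucasProd n k) ≤ ν p (fib c)
  ν≤ p p-prime with p ≟ 2 | p ≟ 3
  ... | yes refl | _ = ≤-trans (ν₂-lucasProd≤ n k) (≤-trans ν₂-bound
                        (p^∣⇒≤ν {e = 5} ≤-refl 0<F (∣-trans (divides 1449 refl) (∣⇒fib∣fib 24∣c))))
  ... | no _ | yes refl = subst (_ ≤_) (sym (ν₃-fib c 0<c (∣-trans (divides 6 refl) 24∣c))) ν₃-bound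
  ... | no p≢2 | no p≢3 =
    ν-lucasProd≤ n k p-prime p≢2 p≢3 k≤6 (λ i i≤k → ν-mono-∣ (prime⇒2≤ p-prime) (L∣F i i≤k) 0<F)

-- Residues modulo 36

≡2[4] : ℕ → Bool
≡2[4] x = x % 4 ≡ᵇ 2

≡0[9] : ℕ → Bool
≡0[9] x = x % 9 ≡ᵇ 0

-- Up to the unknown valuation B of a multiple of 9, ν₃ x = [9 ∣ x] B + ν₃-known x, and
-- by ν₃-lucas, ν₃ L_x = ν₃-lucas-coeff x · B + ν₃-lucas-const x; all are functions of x mod 36.
[9∣] : ℕ → ℕ
[9∣] x = if ≡0[9] x then 1 else 0

ν₃-known : ℕ → ℕ
ν₃-known x = if ≡0[9] x then 0 else ν₃-small (x % 9)

ν₃-lucas-coeff : ℕ → ℕ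
ν₃-lucas-coeff x = if ≡2[4] x then [9∣] x else 0

ν₃-lucas-const : ℕ → ℕ
ν₃-lucas-const x = if ≡2[4] x then suc (ν₃-known x) else 0

hasNine : ℕ → ℕ → Bool
hasNine r k = offset 9 r ≤ᵇ k

coeffSum constSum knownMax : ℕ → ℕ → ℕ
coeffSum r k = sum≤ k (λ i → ν₃-lucas-coeff (r + i))
constSum r k = sum≤ k (λ i → ν₃-lucas-const (r + i))
knownMax r k = max≤ k (λ i → ν₃-known (r + i))

ν₃-certificate-a : ℕ → ℕ → Bool
ν₃-certificate-a r k = if hasNine r k
  then ((coeffSum r k ≡ᵇ 0) ∧ (constSum r k ≤ᵇ 3)) ∨ ((coeffSum r k ≡ᵇ 1) ∧ (constSum r k ≤ᵇ 1))
  else ((coeffSum r k ≡ᵇ 0) ∧ (constSum r k ≤ᵇ suc (knownMax r k)))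

ν₃-certificate-3a : ℕ → ℕ → Bool
ν₃-certificate-3a r k = if hasNine r k
  then ((coeffSum r k ≡ᵇ 1) ∧ (constSum r k ≡ᵇ 2))
  else ((coeffSum r k ≡ᵇ 0) ∧ (constSum r k ≡ᵇ 2 + knownMax r k))

ν₂-certificate : ℕ → ℕ → Bool
ν₂-certificate r k = sum≤ k (λ i → ν₂-lucas-bound ((r + i) % 6)) ≤ᵇ 5

affine-≤-suc : ∀ x y B → 2 ≤ B → T (((x ≡ᵇ 0) ∧ (y ≤ᵇ 3)) ∨ ((x ≡ᵇ 1) ∧ (y ≤ᵇ 1))) → x * B + y ≤ suc B
affine-≤-suc x y B 2≤B cert with Equivalence.to T-∨ cert
... | inj₁ x≡0∧y≤3 with Equivalence.to T-∧ x≡0∧y≤3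
...   | x≡0 , y≤3 rewrite ≡ᵇ⇒≡ x 0 x≡0 = ≤-trans (≤ᵇ⇒≤ y 3 y≤3) (s≤s 2≤B)
affine-≤-suc x y B 2≤B cert | inj₂ x≡1∧y≤1 with Equivalence.to T-∧ x≡1∧y≤1
...   | x≡1 , y≤1 rewrite ≡ᵇ⇒≡ x 1 x≡1 | +-identityʳ B = subst (B + y ≤_) (+-comm B 1) (+-monoʳ-≤ B (≤ᵇ⇒≤ y 1 y≤1))

module _ (n k : ℕ) (1≤n : 1 ≤ n) (3≤k : 3 ≤ k) (k≤6 : k ≤ 6) where

  r : ℕ
  r = n % 36

  β : ℕ
  β = offset 9 n

  B : ℕ
  B = ν 3 (n + β)

  %-transfer : ∀ d i .{{_ : NonZero d}} → d ∣ 36 → (n + i) % d ≡ (r + i) % d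
  %-transfer d i = [n+i]%d≡[n%m+i]%d d 36 n i

  9∣n+β : 9 ∣ n + β
  9∣n+β = ∣n+offset 9 n

  2≤B : 2 ≤ B
  2≤B = p^∣⇒≤ν {e = 2} 2≤3 (≤-trans 1≤n (m≤m+n n β)) 9∣n+β

  9∣n+i⇒i≡β : ∀ i → i ≤ k → 9 ∣ n + i → i ≡ β
  9∣n+i⇒i≡β i i≤k 9∣n+i = offset-unique 9∣n+i 9∣n+β (≤-trans (s≤s (≤-trans i≤k k≤6)) (m≤n+m 7 2)) (offset<m 9 n)

  T≡0[9]⇒9∣ : ∀ i → T (≡0[9] (r + i)) → 9 ∣ n + i
  T≡0[9]⇒9∣ i t = m%n≡0⇒n∣m (n + i) 9 (trans (%-transfer 9 i (divides 4 refl)) (≡ᵇ⇒≡ _ 0 t))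

  9∣⇒T≡0[9] : ∀ i → 9 ∣ n + i → T (≡0[9] (r + i))
  9∣⇒T≡0[9] i 9∣n+i = ≡⇒≡ᵇ _ 0 (trans (sym (%-transfer 9 i (divides 4 refl))) (n∣m⇒m%n≡0 _ 9 9∣n+i))

  ν₃[n+i] : ∀ i → i ≤ k → ν 3 (n + i) ≡ [9∣] (r + i) * B + ν₃-known (r + i)
  ν₃[n+i] i i≤k with ≡0[9] (r + i) in r+i≡0[9]
  ... | true = trans (cong (λ x → ν 3 (n + x)) (9∣n+i⇒i≡β i i≤k (T≡0[9]⇒9∣ i (subst T (sym r+i≡0[9]) tt))))
                     (sym (trans (+-identityʳ (B + 0)) (+-identityʳ B)))
  ... | false = trans (ν₃-by-%9 (n + i) (subst T r+i≡0[9] ∘ 9∣⇒T≡0[9] i)) (cong ν₃-small (%-transfer 9 i (divides 4 refl)))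

  ν₃-lucas[n+i] : ∀ i → i ≤ k → ν 3 (lucas (n + i)) ≡ ν₃-lucas-coeff (r + i) * B + ν₃-lucas-const (r + i)
  ν₃-lucas[n+i] i i≤k with ≡2[4] (r + i) in r+i≡2[4]
  ... | true = begin
    ν 3 (lucas (n + i))                            ≡⟨ ν₃-lucas (n + i) n+i%4≡2 ⟩
    suc (ν 3 (n + i))                              ≡⟨ cong suc (ν₃[n+i] i i≤k) ⟩
    suc ([9∣] (r + i) * B + ν₃-known (r + i))      ≡⟨ +-suc _ _ ⟨
    [9∣] (r + i) * B + suc (ν₃-known (r + i))      ∎
    where
    open ≡-Reasoning
    n+i%4≡2 : (n + i) % 4 ≡ 2
    n+i%4≡2 = trans (%-transfer 4 i (divides 9 refl)) (≡ᵇ⇒≡ _ 2 (subst T (sym r+i≡2[4]) tt))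
  ... | false = ν₃-lucas≡0 (n + i) λ n+i%4≡2 →
    subst T r+i≡2[4] (≡⇒≡ᵇ _ 2 (trans (sym (%-transfer 4 i (divides 9 refl))) n+i%4≡2))

  ν₃-lucasProd : ν 3 (lucasProd n k) ≡ coeffSum r k * B + constSum r k
  ν₃-lucasProd = trans (ν-lucasProd n k 3-prime) (sum≤-affine k B ν₃-lucas[n+i])

  ν₃[n+i]≤ν₃[lcmRange] : ∀ i → i ≤ k → ν 3 (n + i) ≤ ν 3 (lcmRange n k)
  ν₃[n+i]≤ν₃[lcmRange] i i≤k = ν-mono-∣ 2≤3 (n+i∣lcmRange n k i i≤k) (lcmRange-pos k 1≤n)

  β≡offset : β ≡ offset 9 r
  β≡offset = offset-% 9 36 n (divides 4 refl)

  ν₃[lcmRange]≡B : T (hasNine r k) → ν 3 (lcmRange n k) ≡ B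
  ν₃[lcmRange]≡B has-nine = ≤-antisym (ν-lcmRange≤ k 3-prime 1≤n ν₃≤B) (ν₃[n+i]≤ν₃[lcmRange] β β≤k)
    where
    β≤k : β ≤ k
    β≤k = subst (_≤ k) (sym β≡offset) (≤ᵇ⇒≤ _ k has-nine)
    ν₃≤B : ∀ i → i ≤ k → ν 3 (n + i) ≤ B
    ν₃≤B i i≤k with 9 ∣? n + i
    ... | yes 9∣n+i = ≤-reflexive (cong (λ x → ν 3 (n + x)) (9∣n+i⇒i≡β i i≤k 9∣n+i))
    ... | no 9∤n+i = ≤-trans (≤-reflexive (ν₃-by-%9 (n + i) 9∤n+i)) (≤-trans (ν₃-small≤1 _) (≤-trans (s≤s z≤n) 2≤B))

  ν₃[lcmRange]≡knownMax : ¬ T (hasNine r k) → ν 3 (lcmRange n k) ≡ knownMax r k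
  ν₃[lcmRange]≡knownMax no-nine = ≤-antisym
    (ν-lcmRange≤ k 3-prime 1≤n (λ i i≤k → ≤-trans (≤-reflexive (ν₃≡known i i≤k)) (max≤-upper k i i≤k)))
    (max≤-least k (λ i i≤k → ≤-trans (≤-reflexive (sym (ν₃≡known i i≤k))) (ν₃[n+i]≤ν₃[lcmRange] i i≤k)))
    where
    ν₃≡known : ∀ i → i ≤ k → ν 3 (n + i) ≡ ν₃-known (r + i)
    ν₃≡known i i≤k with ≡0[9] (r + i) in r+i≡0[9] | ν₃[n+i] i i≤k
    ... | false | ν₃≡ = ν₃≡
    ... | true  | _ = ⊥-elim (no-nine (≤⇒≤ᵇ (subst (_≤ k) i≡offset i≤k)))
      where
      i≡offset : i ≡ offset 9 r
      i≡offset = trans (9∣n+i⇒i≡β i i≤k (T≡0[9]⇒9∣ i (subst T (sym r+i≡0[9]) tt))) β≡offset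

  ν₃-lucasProd≤ : T (ν₃-certificate-a r k) → ν 3 (lucasProd n k) ≤ suc (ν 3 (lcmRange n k))
  ν₃-lucasProd≤ cert with hasNine r k in has-nine
  ... | true = subst₂ (λ x y → x ≤ suc y) (sym ν₃-lucasProd) (sym (ν₃[lcmRange]≡B (subst T (sym has-nine) tt)))
                 (affine-≤-suc (coeffSum r k) (constSum r k) B 2≤B cert)
  ... | false with Equivalence.to (T-∧ {coeffSum r k ≡ᵇ 0} {constSum r k ≤ᵇ suc (knownMax r k)}) cert
  ...   | SB≡0 , S0≤1+MK = begin
    ν 3 (lucasProd n k)                   ≡⟨ ν₃-lucasProd ⟩
    coeffSum r k * B + constSum r k       ≡⟨ cong (λ x → x * B + constSum r k) (≡ᵇ⇒≡ (coeffSum r k) 0 SB≡0) ⟩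
    constSum r k                          ≤⟨ ≤ᵇ⇒≤ (constSum r k) (suc (knownMax r k)) S0≤1+MK ⟩
    suc (knownMax r k)                    ≡⟨ cong suc (ν₃[lcmRange]≡knownMax (subst T has-nine)) ⟨
    suc (ν 3 (lcmRange n k))              ∎
    where open ≤-Reasoning

  ν₃-lucasProd≡ : T (ν₃-certificate-3a r k) → ν 3 (lucasProd n k) ≡ suc (suc (ν 3 (lcmRange n k)))
  ν₃-lucasProd≡ cert with hasNine r k in has-nine
  ... | true with Equivalence.to (T-∧ {coeffSum r k ≡ᵇ 1} {constSum r k ≡ᵇ 2}) cert
  ...   | SB≡1 , S0≡2 = begin
    ν 3 (lucasProd n k)                   ≡⟨ ν₃-lucasProd ⟩
    coeffSum r k * B + constSum r k
      ≡⟨ cong₂ (λ x y → x * B + y) (≡ᵇ⇒≡ (coeffSum r k) 1 SB≡1) (≡ᵇ⇒≡ (constSum r k) 2 S0≡2) ⟩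
    1 * B + 2                             ≡⟨ 1*B+2≡2+B B ⟩
    suc (suc B)                           ≡⟨ cong (suc ∘ suc) (ν₃[lcmRange]≡B (subst T (sym has-nine) tt)) ⟨
    suc (suc (ν 3 (lcmRange n k)))        ∎
    where
    open ≡-Reasoning
    1*B+2≡2+B : ∀ B → 1 * B + 2 ≡ suc (suc B)
    1*B+2≡2+B = solve-∀
  ν₃-lucasProd≡ cert | false with Equivalence.to (T-∧ {coeffSum r k ≡ᵇ 0} {constSum r k ≡ᵇ 2 + knownMax r k}) cert
  ...   | SB≡0 , S0≡2+MK = begin
    ν 3 (lucasProd n k)                   ≡⟨ ν₃-lucasProd ⟩
    coeffSum r k * B + constSum r k
      ≡⟨ cong₂ (λ x y → x * B + y) (≡ᵇ⇒≡ (coeffSum r k) 0 SB≡0) (≡ᵇ⇒≡ (constSum r k) (2 + knownMax r k) S0≡2+MK) ⟩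
    suc (suc (knownMax r k))              ≡⟨ cong (suc ∘ suc) (ν₃[lcmRange]≡knownMax (subst T has-nine)) ⟨
    suc (suc (ν 3 (lcmRange n k)))        ∎
    where open ≡-Reasoning

  0<lcmRange : 0 < lcmRange n k
  0<lcmRange = lcmRange-pos k 1≤n

  0<a : 0 < 2 * lcmRange n k
  0<a = 0<m*n {2} z<s 0<lcmRange

  24∣a : 24 ∣ 2 * lcmRange n k
  24∣a = *-monoʳ-∣ 2 (lcm-least (∣lcmRange n k 3 (≤-trans (n≤1+n 3) (s≤s 3≤k))) (∣lcmRange n k 4 (s≤s 3≤k)))

  ν₂-bound : T (ν₂-certificate r k) → sum≤ k (λ i → ν₂-lucas-bound ((n + i) % 6)) ≤ 5
  ν₂-bound cert = ≤-trans (sum≤-mono-≤ k (λ i _ → ≤-reflexive (cong ν₂-lucas-bound (%-transfer 6 i (divides 6 refl)))))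
                          (≤ᵇ⇒≤ _ 5 cert)

  lucasProd∣fib⇒a∣ : ∀ j → lucasProd n k ∣ fib j → 2 * lcmRange n k ∣ j
  lucasProd∣fib⇒a∣ j = lucasProd∣fib⇒∣ n k 1≤n (≤-trans (s≤s z≤n) 3≤k)

  rank≡a : T (ν₂-certificate r k) → T (ν₃-certificate-a r k) → IsRankOfApparition (lucasProd n k) (2 * lcmRange n k)
  rank≡a ν₂-cert ν₃-cert = rank-by-divisibility 0<a
    (lucasProd∣fib n k k≤6 0<a 24∣a ∣-refl (ν₂-bound ν₂-cert)
      (subst (λ x → ν 3 (lucasProd n k) ≤ suc x) (sym (ν₃[2*m] _ 0<lcmRange)) (ν₃-lucasProd≤ ν₃-cert)))
    lucasProd∣fib⇒a∣

  rank≡3a : T (ν₂-certificate r k) → T (ν₃-certificate-3a r k) → IsRankOfApparition (lucasProd n k) (3 * (2 * lcmRange n k))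
  rank≡3a ν₂-cert ν₃-cert = rank-triple 0<a
    (lucasProd∣fib n k k≤6 (0<m*n {3} z<s 0<a) (∣-trans 24∣a (n∣m*n 3)) (n∣m*n 3) (ν₂-bound ν₂-cert)
      (≤-reflexive ν₃b≡1+ν₃[3a]))
    b∤F[a] lucasProd∣fib⇒a∣
    where
    ν₃b≡2+ν₃a : ν 3 (lucasProd n k) ≡ suc (suc (ν 3 (2 * lcmRange n k)))
    ν₃b≡2+ν₃a = trans (ν₃-lucasProd≡ ν₃-cert) (cong (suc ∘ suc) (sym (ν₃[2*m] _ 0<lcmRange)))
    ν₃b≡1+ν₃[3a] : ν 3 (lucasProd n k) ≡ suc (ν 3 (3 * (2 * lcmRange n k)))
    ν₃b≡1+ν₃[3a] = trans ν₃b≡2+ν₃a (cong suc (sym (ν₃[3*m] _ 0<a)))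
    b∤F[a] : ¬ lucasProd n k ∣ fib (2 * lcmRange n k)
    b∤F[a] b∣F[a] = <-irrefl refl (begin-strict
      suc (ν 3 (2 * lcmRange n k))          <⟨ n<1+n _ ⟩
      suc (suc (ν 3 (2 * lcmRange n k)))    ≡⟨ ν₃b≡2+ν₃a ⟨
      ν 3 (lucasProd n k)                   ≤⟨ ν-mono-∣ 2≤3 b∣F[a] (0<fib 0<a) ⟩
      ν 3 (fib (2 * lcmRange n k))          ≡⟨ ν₃-fib _ 0<a (∣-trans (divides 6 refl) 24∣a) ⟩
      suc (ν 3 (2 * lcmRange n k))          ∎)
      where open ≤-Reasoning

residue-certificate : ℕ → List ℕ → ℕ → Bool
residue-certificate k L r = ν₂-certificate r k ∧ (if does (r ∈? L) then ν₃-certificate-3a r k else ν₃-certificate-a r k)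

residue-certificate-cases : ∀ k L r → T (residue-certificate k L r) →
  T (ν₂-certificate r k) × (r ∈ L → T (ν₃-certificate-3a r k)) × (¬ r ∈ L → T (ν₃-certificate-a r k))
residue-certificate-cases k L r cert with Equivalence.to (T-∧ {ν₂-certificate r k}) cert
... | ν₂-cert , ν₃-cert with r ∈? L
...   | yes r∈L = ν₂-cert , (λ _ → ν₃-cert) , λ r∉L → ⊥-elim (r∉L r∈L)
...   | no r∉L = ν₂-cert , (λ r∈L → ⊥-elim (r∉L r∈L)) , λ _ → ν₃-cert

rank-lucasProd : ∀ k L → 3 ≤ k → k ≤ 6 → (∀ {r} → r < 36 → T (residue-certificate k L r)) → ∀ n → 1 ≤ n →
  (n % 36 ∈ L → IsRankOfApparition (lucasProd n k) (3 * (2 * lcmRange n k))) ×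
  (¬ n % 36 ∈ L → IsRankOfApparition (lucasProd n k) (2 * lcmRange n k))
rank-lucasProd k L 3≤k k≤6 cert n 1≤n with residue-certificate-cases k L (n % 36) (cert (m%n<n n 36))
... | ν₂-cert , ν₃-cert-3a , ν₃-cert-a =
  rank≡3a n k 1≤n 3≤k k≤6 ν₂-cert ∘ ν₃-cert-3a , rank≡a n k 1≤n 3≤k k≤6 ν₂-cert ∘ ν₃-cert-a

theorem4p5 : (n : ℕ) → 1 ≤ n →
    let a4 = 2 * lcmRange n 4
        b4 = lucasProd n 4
        a5 = 2 * lcmRange n 5
        b5 = lucasProd n 5
        a6 = 2 * lcmRange n 6
        b6 = lucasProd n 6
        r = n % 36
    in ((r ∈ 2 ∷ 14 ∷ 18 ∷ 30 ∷ [] → IsRankOfApparition b4 (3 * a4))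
        × (¬ (r ∈ 2 ∷ 14 ∷ 18 ∷ 30 ∷ []) → IsRankOfApparition b4 a4))
     × ((r ∈ 1 ∷ 2 ∷ 13 ∷ 14 ∷ 17 ∷ 18 ∷ 29 ∷ 30 ∷ [] → IsRankOfApparition b5 (3 * a5))
        × (¬ (r ∈ 1 ∷ 2 ∷ 13 ∷ 14 ∷ 17 ∷ 18 ∷ 29 ∷ 30 ∷ []) → IsRankOfApparition b5 a5))
     × ((r ∈ 1 ∷ 2 ∷ 12 ∷ 13 ∷ 14 ∷ 16 ∷ 17 ∷ 18 ∷ 28 ∷ 29 ∷ [] → IsRankOfApparition b6 (3 * a6))
        × (¬ (r ∈ 1 ∷ 2 ∷ 12 ∷ 13 ∷ 14 ∷ 16 ∷ 17 ∷ 18 ∷ 28 ∷ 29 ∷ []) → IsRankOfApparition b6 a6))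
theorem4p5 n 1≤n =
  rank-for 4 (2 ∷ 14 ∷ 18 ∷ 30 ∷ []) ,
  rank-for 5 (1 ∷ 2 ∷ 13 ∷ 14 ∷ 17 ∷ 18 ∷ 29 ∷ 30 ∷ []) ,
  rank-for 6 (1 ∷ 2 ∷ 12 ∷ 13 ∷ 14 ∷ 16 ∷ 17 ∷ 18 ∷ 28 ∷ 29 ∷ [])
  where
  rank-for : ∀ k L → {3≤k : True (3 ≤? k)} → {k≤6 : True (k ≤? 6)} → {cert : True (allUpTo? (T? ∘ residue-certificate k L) 36)} →
    (n % 36 ∈ L → IsRankOfApparition (lucasProd n k) (3 * (2 * lcmRange n k))) ×
    (¬ n % 36 ∈ L → IsRankOfApparition (lucasProd n k) (2 * lcmRange n k))
  rank-for k L {3≤k} {k≤6} {cert} = rank-lucasProd k L (toWitness 3≤k) (toWitness k≤6) (toWitness cert) n 1≤n
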